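{- For integers $k\geqslant 1$ and $\ell\in\mathbb{Z}$, let $$H_{\ell,k}=\Big\{\underline{h}=(h_0,\dots,h_\ell)\in(\mathbb{N}^*)^{\ell+1}\;\Big|\;\sum_{v=0}^{\ell}h_v=k\Big\},$$ with the convention $H_{\ell,k}=\varnothing$ if $\ell\notin\{0,\dots,k-1\}$, and for $\underline{h}\in H_{\ell,k}$ let $$\varphi(\underline{h},X)=\frac{\prod_{m=1}^{k-1}(X+1-m)}{\prod_{u=0}^{\ell-1}\big(X+1-\sum_{v=0}^{u}h_v\big)}\in\mathbb{Q}[X]$$ (an empty product being $1$). Then for all $k\in\mathbb{N}^*$ and $\ell\in\mathbb{Z}$, $$\sum_{\underline{h}\in H_{\ell,k+1}}\varphi(\underline{h},X)=(X-k+1)\sum_{\underline{h}'\in H_{\ell,k}}\varphi(\underline{h}',X)+\sum_{\underline{h}'\in H_{\ell-1,k}}\varphi(\underline{h}',X).$$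
   Context: $\mathbb{N}^*$ denotes the positive integers. Each factor of the denominator of $\varphi(\underline{h},X)$ appears in its numerator, so $\varphi(\underline{h},X)$ is a polynomial. -}

module Defs where

open import Data.Nat as ℕ using (ℕ; zero; suc; _≟_)
open import Data.Integer as ℤ using (ℤ; +_; -[1+_])
open import Data.Rational as ℚ using (ℚ; 0ℚ; 1ℚ)
open import Data.List using (List; []; _∷_; map; foldr; concatMap; filter; upTo)
open import Data.Nat.ListAction using (sum)
open import Relation.Binary.PropositionalEquality using (_≡_)

-- Polynomials in ℚ[X], as coefficient lists (lowest degree first).
Poly : Set
Poly = List ℚ

coeff : Poly → ℕ → ℚ
coeff []       _       = 0ℚ
coeff (a ∷ p)  zero    = a
coeff (a ∷ p)  (suc i) = coeff p i

infix 4 _≈ₚ_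
_≈ₚ_ : Poly → Poly → Set
p ≈ₚ q = ∀ i → coeff p i ≡ coeff q i

infixl 6 _+ₚ_
_+ₚ_ : Poly → Poly → Poly
[]      +ₚ q       = q
(a ∷ p) +ₚ []      = a ∷ p
(a ∷ p) +ₚ (b ∷ q) = (a ℚ.+ b) ∷ (p +ₚ q)

infixl 7 _*ₚ_
_*ₚ_ : Poly → Poly → Poly
[]      *ₚ q = []
(a ∷ p) *ₚ q = map (a ℚ.*_) q +ₚ (0ℚ ∷ (p *ₚ q))

oneₚ : Poly
oneₚ = 1ℚ ∷ []

lin : ℕ → Poly
lin m = (1ℚ ℚ.- ((+ m) ℚ./ 1)) ∷ 1ℚ ∷ []

prodₚ : List Poly → Poly
prodₚ = foldr _*ₚ_ oneₚ

sumₚ : List Poly → Poly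
sumₚ = foldr _+ₚ_ []

-- numerator of φ(h,X) when h sums to n : ∏_{m=1}^{n-1} (X + 1 - m)
num : ℕ → Poly
num n = prodₚ (map (λ m → lin (suc m)) (upTo (n ℕ.∸ 1)))

-- denominator of φ(h,X) for h = (h_0,…,h_ℓ):
-- ∏_{u=0}^{ℓ-1} (X + 1 - (h_0+…+h_u)); `acc` is the running partial sum
denAux : ℕ → List ℕ → Poly
denAux acc []            = oneₚ
denAux acc (h ∷ [])      = oneₚ
denAux acc (h ∷ t ∷ hs)  = lin (acc ℕ.+ h) *ₚ denAux (acc ℕ.+ h) (t ∷ hs)

den : List ℕ → Poly
den = denAux 0

tuples : ℕ → ℕ → List (List ℕ)
tuples n zero      = [] ∷ []
tuples n (suc len) = concatMap (λ a → map (a ∷_) (tuples n len)) (map suc (upTo n))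

H : ℤ → ℕ → List (List ℕ)
H (+ l)    k = filter (λ h → sum h ≟ k) (tuples k (suc l))
H -[1+ _ ] k = []

{-# OPTIONS --safe #-}
module Submission where

-- Sort H_{ℓ,k+1} by its last part h_ℓ. Lowering a last part h_ℓ ≥ 2 by one is a bijection onto
-- H_{ℓ,k}, and deleting a last part h_ℓ = 1 is a bijection onto H_{ℓ-1,k}. Raising the last part
-- leaves the denominator of φ unchanged while the numerator gains the factor X + 1 - k, so φ is
-- multiplied by X - k + 1; appending a part 1 multiplies the denominator by
-- X + 1 - (h_0 + … + h_{ℓ-1}) = X + 1 - k, exactly the factor gained by the numerator, so φ is
-- unchanged. As φ is only given through φ · den = num, both facts are obtained by cancelling the
-- monic linear factors of den in ℚ[X].

open import Defs
open import Level using (Level; 0ℓ)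
open import Function using (_∘_)
open import Data.Bool using (true; false)
open import Data.Product using (_,_)
open import Data.Nat as ℕ using (ℕ; zero; suc; _∸_; _≤_; _<_; _≤′_; z≤n; z<s; _≟_)
import Data.Nat.Properties as ℕP
open import Data.Nat.ListAction using (sum)
open import Data.Nat.ListAction.Properties using (sum-++)
open import Data.Integer using (ℤ; _-_; +_; -[1+_])
open import Data.Rational as ℚ using (ℚ; 0ℚ; 1ℚ)
import Data.Rational.Properties as ℚP
open import Data.Rational.Solver using (module +-*-Solver)
open import Data.List
  using (List; []; _∷_; [_]; map; foldr; _++_; _∷ʳ_; concat; concatMap; filter; upTo; length)
open import Data.List.Properties
  using ( map-∘; map-cong-local; upTo-∷ʳ; concatMap-++; concatMap-map; ++-identityʳ; length-++
        ; filter-++; filter-none; filter-≐)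
open import Data.List.Membership.Propositional using (_∈_; find; lose)
open import Data.List.Membership.Propositional.Properties
  using (∈-concatMap⁺; ∈-concatMap⁻; ∈-map⁺; ∈-map⁻; ∈-upTo⁺; ∈-upTo⁻)
open import Data.List.Relation.Unary.All as All using (All; []; _∷_)
open import Data.List.Relation.Unary.All.Properties using (all-upTo; ∷ʳ⁺)
open import Data.List.Relation.Unary.Any using (here; there)
open import Algebra.Bundles using (CommutativeMonoid; CommutativeSemiring)
open import Algebra.Structures using (IsCommutativeMonoid)
open import Algebra.Structures.Biased using (isCommutativeMonoidˡ; isCommutativeSemiringˡ)
open import Algebra.Properties.Group ℚP.+-0-group using (∙-cancelˡ)
import Algebra.Properties.CommutativeSemigroup as CommutativeSemigroupProperties
open import Relation.Nullary using (Dec; yes; no; does)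
open import Relation.Unary using (Pred; Decidable)
open import Relation.Binary.Structures using (IsEquivalence)
open import Relation.Binary.PropositionalEquality
  using (_≡_; _≢_; _≗_; refl; sym; trans; cong; cong₂; subst; module ≡-Reasoning)
import Relation.Binary.Reasoning.Setoid as SetoidReasoning

private variable
  a p : Level
  A B : Set a

-- (f ⋆ g) n = Σ_{i+j=n} f i * g j, unfolded by splitting off the term i = 0. The semiring laws
-- of ℚ[X] are transported along coeff from the corresponding laws of ⋆.
infixl 7 _⋆_
_⋆_ : (ℕ → ℚ) → (ℕ → ℚ) → ℕ → ℚ
(f ⋆ g) zero    = f 0 ℚ.* g 0
(f ⋆ g) (suc n) = f 0 ℚ.* g (suc n) ℚ.+ ((f ∘ suc) ⋆ g) n

⋆-cong : ∀ {f f′ g g′} → f ≗ f′ → g ≗ g′ → f ⋆ g ≗ f′ ⋆ g′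
⋆-cong f≗f′ g≗g′ zero    = cong₂ ℚ._*_ (f≗f′ 0) (g≗g′ 0)
⋆-cong f≗f′ g≗g′ (suc n) =
  cong₂ ℚ._+_ (cong₂ ℚ._*_ (f≗f′ 0) (g≗g′ (suc n))) (⋆-cong (f≗f′ ∘ suc) g≗g′ n)

⋆-zeroˡ : ∀ g → (λ _ → 0ℚ) ⋆ g ≗ (λ _ → 0ℚ)
⋆-zeroˡ g zero    = ℚP.*-zeroˡ (g 0)
⋆-zeroˡ g (suc n) = cong₂ ℚ._+_ (ℚP.*-zeroˡ (g (suc n))) (⋆-zeroˡ g n)

⋆-identityˡ : ∀ f → coeff oneₚ ⋆ f ≗ f
⋆-identityˡ f zero    = ℚP.*-identityˡ (f 0)
⋆-identityˡ f (suc n) = begin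
  1ℚ ℚ.* f (suc n) ℚ.+ ((λ _ → 0ℚ) ⋆ f) n ≡⟨ cong₂ ℚ._+_ (ℚP.*-identityˡ (f (suc n))) (⋆-zeroˡ f n) ⟩
  f (suc n) ℚ.+ 0ℚ                         ≡⟨ ℚP.+-identityʳ (f (suc n)) ⟩
  f (suc n)                                ∎
  where open ≡-Reasoning

⋆-sucʳ : ∀ f g n → (f ⋆ g) (suc n) ≡ (f ⋆ (g ∘ suc)) n ℚ.+ f (suc n) ℚ.* g 0
⋆-sucʳ f g zero    = refl
⋆-sucʳ f g (suc n) = begin
  f 0 ℚ.* g (suc (suc n)) ℚ.+ ((f ∘ suc) ⋆ g) (suc n)
    ≡⟨ cong (f 0 ℚ.* g (suc (suc n)) ℚ.+_) (⋆-sucʳ (f ∘ suc) g n) ⟩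
  f 0 ℚ.* g (suc (suc n)) ℚ.+ (((f ∘ suc) ⋆ (g ∘ suc)) n ℚ.+ f (suc (suc n)) ℚ.* g 0)
    ≡⟨ ℚP.+-assoc (f 0 ℚ.* g (suc (suc n))) (((f ∘ suc) ⋆ (g ∘ suc)) n) (f (suc (suc n)) ℚ.* g 0) ⟨
  (f ⋆ (g ∘ suc)) (suc n) ℚ.+ f (suc (suc n)) ℚ.* g 0
    ∎
  where open ≡-Reasoning

⋆-comm : ∀ f g → f ⋆ g ≗ g ⋆ f
⋆-comm f g zero    = ℚP.*-comm (f 0) (g 0)
⋆-comm f g (suc n) = begin
  f 0 ℚ.* g (suc n) ℚ.+ ((f ∘ suc) ⋆ g) n
    ≡⟨ cong (f 0 ℚ.* g (suc n) ℚ.+_) (⋆-comm (f ∘ suc) g n) ⟩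
  f 0 ℚ.* g (suc n) ℚ.+ (g ⋆ (f ∘ suc)) n
    ≡⟨ solve 3 (λ a b c → a :* b :+ c := c :+ b :* a) refl (f 0) (g (suc n)) _ ⟩
  (g ⋆ (f ∘ suc)) n ℚ.+ g (suc n) ℚ.* f 0
    ≡⟨ ⋆-sucʳ g f n ⟨
  (g ⋆ f) (suc n)
    ∎
  where
  open ≡-Reasoning
  open +-*-Solver

⋆-distribʳ : ∀ f g h → (λ i → f i ℚ.+ g i) ⋆ h ≗ (λ n → (f ⋆ h) n ℚ.+ (g ⋆ h) n)
⋆-distribʳ f g h zero    = ℚP.*-distribʳ-+ (h 0) (f 0) (g 0)
⋆-distribʳ f g h (suc n) = begin
  (f 0 ℚ.+ g 0) ℚ.* h (suc n) ℚ.+ ((λ i → f (suc i) ℚ.+ g (suc i)) ⋆ h) n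
    ≡⟨ cong ((f 0 ℚ.+ g 0) ℚ.* h (suc n) ℚ.+_) (⋆-distribʳ (f ∘ suc) (g ∘ suc) h n) ⟩
  (f 0 ℚ.+ g 0) ℚ.* h (suc n) ℚ.+ (((f ∘ suc) ⋆ h) n ℚ.+ ((g ∘ suc) ⋆ h) n)
    ≡⟨ solve 5 (λ a b c x y → (a :+ b) :* c :+ (x :+ y) := (a :* c :+ x) :+ (b :* c :+ y)) refl
         (f 0) (g 0) (h (suc n)) _ _ ⟩
  (f ⋆ h) (suc n) ℚ.+ (g ⋆ h) (suc n)
    ∎
  where
  open ≡-Reasoning
  open +-*-Solver

⋆-scaleˡ : ∀ a f g → (λ i → a ℚ.* f i) ⋆ g ≗ (λ n → a ℚ.* (f ⋆ g) n)
⋆-scaleˡ a f g zero    = ℚP.*-assoc a (f 0) (g 0)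
⋆-scaleˡ a f g (suc n) = begin
  a ℚ.* f 0 ℚ.* g (suc n) ℚ.+ ((λ i → a ℚ.* f (suc i)) ⋆ g) n
    ≡⟨ cong (a ℚ.* f 0 ℚ.* g (suc n) ℚ.+_) (⋆-scaleˡ a (f ∘ suc) g n) ⟩
  a ℚ.* f 0 ℚ.* g (suc n) ℚ.+ a ℚ.* ((f ∘ suc) ⋆ g) n
    ≡⟨ solve 4 (λ a b c x → a :* b :* c :+ a :* x := a :* (b :* c :+ x)) refl a (f 0) (g (suc n)) _ ⟩
  a ℚ.* (f ⋆ g) (suc n)
    ∎
  where
  open ≡-Reasoning
  open +-*-Solver

⋆-assoc : ∀ f g h → (f ⋆ g) ⋆ h ≗ f ⋆ (g ⋆ h)
⋆-assoc f g h zero    = ℚP.*-assoc (f 0) (g 0) (h 0)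
⋆-assoc f g h (suc n) = begin
  f 0 ℚ.* g 0 ℚ.* h (suc n) ℚ.+ (fg′ ⋆ h) n
    ≡⟨ cong (f 0 ℚ.* g 0 ℚ.* h (suc n) ℚ.+_) fg′⋆h ⟩
  f 0 ℚ.* g 0 ℚ.* h (suc n) ℚ.+ (f 0 ℚ.* ((g ∘ suc) ⋆ h) n ℚ.+ ((f ∘ suc) ⋆ (g ⋆ h)) n)
    ≡⟨ solve 5 (λ a b c x y → a :* b :* c :+ (a :* x :+ y) := a :* (b :* c :+ x) :+ y) refl
         (f 0) (g 0) (h (suc n)) _ _ ⟩
  (f ⋆ (g ⋆ h)) (suc n)
    ∎
  where
  open ≡-Reasoning
  open +-*-Solver
  fg′ : ℕ → ℚ
  fg′ = (f ⋆ g) ∘ suc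
  fg′⋆h : (fg′ ⋆ h) n ≡ f 0 ℚ.* ((g ∘ suc) ⋆ h) n ℚ.+ ((f ∘ suc) ⋆ (g ⋆ h)) n
  fg′⋆h = begin
    (fg′ ⋆ h) n                                                       ≡⟨ ⋆-distribʳ _ _ h n ⟩
    ((λ i → f 0 ℚ.* g (suc i)) ⋆ h) n ℚ.+ (((f ∘ suc) ⋆ g) ⋆ h) n     ≡⟨ cong₂ ℚ._+_ (⋆-scaleˡ (f 0) (g ∘ suc) h n)
                                                                                      (⋆-assoc (f ∘ suc) g h n) ⟩
    f 0 ℚ.* ((g ∘ suc) ⋆ h) n ℚ.+ ((f ∘ suc) ⋆ (g ⋆ h)) n             ∎

-- ℚ[X] as a commutative semiring

coeff-+ : ∀ p q i → coeff (p +ₚ q) i ≡ coeff p i ℚ.+ coeff q i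
coeff-+ []      q       i       = sym (ℚP.+-identityˡ (coeff q i))
coeff-+ (a ∷ p) []      i       = sym (ℚP.+-identityʳ (coeff (a ∷ p) i))
coeff-+ (a ∷ p) (b ∷ q) zero    = refl
coeff-+ (a ∷ p) (b ∷ q) (suc i) = coeff-+ p q i

coeff-scale : ∀ a q i → coeff (map (a ℚ.*_) q) i ≡ a ℚ.* coeff q i
coeff-scale a []      i       = sym (ℚP.*-zeroʳ a)
coeff-scale a (b ∷ q) zero    = refl
coeff-scale a (b ∷ q) (suc i) = coeff-scale a q i

coeff-* : ∀ p q → coeff (p *ₚ q) ≗ coeff p ⋆ coeff q
coeff-* []      q i       = sym (⋆-zeroˡ (coeff q) i)
coeff-* (a ∷ p) q zero    = begin
  coeff (map (a ℚ.*_) q +ₚ (0ℚ ∷ p *ₚ q)) 0  ≡⟨ coeff-+ (map (a ℚ.*_) q) (0ℚ ∷ p *ₚ q) 0 ⟩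
  coeff (map (a ℚ.*_) q) 0 ℚ.+ 0ℚ           ≡⟨ ℚP.+-identityʳ _ ⟩
  coeff (map (a ℚ.*_) q) 0                  ≡⟨ coeff-scale a q 0 ⟩
  a ℚ.* coeff q 0                           ∎
  where open ≡-Reasoning
coeff-* (a ∷ p) q (suc i) = begin
  coeff (map (a ℚ.*_) q +ₚ (0ℚ ∷ p *ₚ q)) (suc i)     ≡⟨ coeff-+ (map (a ℚ.*_) q) (0ℚ ∷ p *ₚ q) (suc i) ⟩
  coeff (map (a ℚ.*_) q) (suc i) ℚ.+ coeff (p *ₚ q) i ≡⟨ cong₂ ℚ._+_ (coeff-scale a q (suc i)) (coeff-* p q i) ⟩
  a ℚ.* coeff q (suc i) ℚ.+ (coeff p ⋆ coeff q) i     ∎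
  where open ≡-Reasoning

-- _≈ₚ_ unfolds to a Π-type from which Agda cannot recover the two polynomials; wrapping it in a
-- record makes the relation injective, so that implicit arguments of the semiring laws get solved.
infix 4 _≋_
record _≋_ (p q : Poly) : Set where
  constructor ≈ₚ⇒≋
  field ≋⇒≈ₚ : p ≈ₚ q
open _≋_ public

≋-isEquivalence : IsEquivalence _≋_
≋-isEquivalence = record
  { refl  = ≈ₚ⇒≋ (λ _ → refl)
  ; sym   = λ (≈ₚ⇒≋ p≈q) → ≈ₚ⇒≋ (sym ∘ p≈q)
  ; trans = λ (≈ₚ⇒≋ p≈q) (≈ₚ⇒≋ q≈r) → ≈ₚ⇒≋ (λ i → trans (p≈q i) (q≈r i))
  }

+ₚ-cong : ∀ {p p′ q q′} → p ≋ p′ → q ≋ q′ → p +ₚ q ≋ p′ +ₚ q′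
+ₚ-cong {p} {p′} {q} {q′} (≈ₚ⇒≋ p≈p′) (≈ₚ⇒≋ q≈q′) = ≈ₚ⇒≋ λ i → begin
  coeff (p +ₚ q) i           ≡⟨ coeff-+ p q i ⟩
  coeff p i ℚ.+ coeff q i    ≡⟨ cong₂ ℚ._+_ (p≈p′ i) (q≈q′ i) ⟩
  coeff p′ i ℚ.+ coeff q′ i  ≡⟨ coeff-+ p′ q′ i ⟨
  coeff (p′ +ₚ q′) i         ∎
  where open ≡-Reasoning

+ₚ-assoc : ∀ p q r → (p +ₚ q) +ₚ r ≋ p +ₚ (q +ₚ r)
+ₚ-assoc p q r = ≈ₚ⇒≋ λ i → begin
  coeff ((p +ₚ q) +ₚ r) i                  ≡⟨ coeff-+ (p +ₚ q) r i ⟩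
  coeff (p +ₚ q) i ℚ.+ coeff r i           ≡⟨ cong (ℚ._+ coeff r i) (coeff-+ p q i) ⟩
  coeff p i ℚ.+ coeff q i ℚ.+ coeff r i    ≡⟨ ℚP.+-assoc (coeff p i) (coeff q i) (coeff r i) ⟩
  coeff p i ℚ.+ (coeff q i ℚ.+ coeff r i)  ≡⟨ cong (coeff p i ℚ.+_) (coeff-+ q r i) ⟨
  coeff p i ℚ.+ coeff (q +ₚ r) i           ≡⟨ coeff-+ p (q +ₚ r) i ⟨
  coeff (p +ₚ (q +ₚ r)) i                  ∎
  where open ≡-Reasoning

+ₚ-comm : ∀ p q → p +ₚ q ≋ q +ₚ p
+ₚ-comm p q = ≈ₚ⇒≋ λ i → begin
  coeff (p +ₚ q) i         ≡⟨ coeff-+ p q i ⟩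
  coeff p i ℚ.+ coeff q i  ≡⟨ ℚP.+-comm (coeff p i) (coeff q i) ⟩
  coeff q i ℚ.+ coeff p i  ≡⟨ coeff-+ q p i ⟨
  coeff (q +ₚ p) i         ∎
  where open ≡-Reasoning

*ₚ-cong : ∀ {p p′ q q′} → p ≋ p′ → q ≋ q′ → p *ₚ q ≋ p′ *ₚ q′
*ₚ-cong {p} {p′} {q} {q′} (≈ₚ⇒≋ p≈p′) (≈ₚ⇒≋ q≈q′) = ≈ₚ⇒≋ λ i → begin
  coeff (p *ₚ q) i         ≡⟨ coeff-* p q i ⟩
  (coeff p ⋆ coeff q) i    ≡⟨ ⋆-cong p≈p′ q≈q′ i ⟩
  (coeff p′ ⋆ coeff q′) i  ≡⟨ coeff-* p′ q′ i ⟨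
  coeff (p′ *ₚ q′) i       ∎
  where open ≡-Reasoning

*ₚ-assoc : ∀ p q r → (p *ₚ q) *ₚ r ≋ p *ₚ (q *ₚ r)
*ₚ-assoc p q r = ≈ₚ⇒≋ λ i → begin
  coeff ((p *ₚ q) *ₚ r) i           ≡⟨ coeff-* (p *ₚ q) r i ⟩
  (coeff (p *ₚ q) ⋆ coeff r) i      ≡⟨ ⋆-cong (coeff-* p q) (λ _ → refl) i ⟩
  (coeff p ⋆ coeff q ⋆ coeff r) i   ≡⟨ ⋆-assoc (coeff p) (coeff q) (coeff r) i ⟩
  (coeff p ⋆ (coeff q ⋆ coeff r)) i ≡⟨ ⋆-cong (λ _ → refl) (coeff-* q r) i ⟨
  (coeff p ⋆ coeff (q *ₚ r)) i      ≡⟨ coeff-* p (q *ₚ r) i ⟨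
  coeff (p *ₚ (q *ₚ r)) i           ∎
  where open ≡-Reasoning

*ₚ-comm : ∀ p q → p *ₚ q ≋ q *ₚ p
*ₚ-comm p q = ≈ₚ⇒≋ λ i → begin
  coeff (p *ₚ q) i       ≡⟨ coeff-* p q i ⟩
  (coeff p ⋆ coeff q) i  ≡⟨ ⋆-comm (coeff p) (coeff q) i ⟩
  (coeff q ⋆ coeff p) i  ≡⟨ coeff-* q p i ⟨
  coeff (q *ₚ p) i       ∎
  where open ≡-Reasoning

*ₚ-identityˡ : ∀ p → oneₚ *ₚ p ≋ p
*ₚ-identityˡ p = ≈ₚ⇒≋ λ i → trans (coeff-* oneₚ p i) (⋆-identityˡ (coeff p) i)

*ₚ-distribʳ : ∀ r p q → (p +ₚ q) *ₚ r ≋ p *ₚ r +ₚ q *ₚ r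
*ₚ-distribʳ r p q = ≈ₚ⇒≋ λ i → begin
  coeff ((p +ₚ q) *ₚ r) i                          ≡⟨ coeff-* (p +ₚ q) r i ⟩
  (coeff (p +ₚ q) ⋆ coeff r) i                     ≡⟨ ⋆-cong (coeff-+ p q) (λ _ → refl) i ⟩
  ((λ j → coeff p j ℚ.+ coeff q j) ⋆ coeff r) i    ≡⟨ ⋆-distribʳ (coeff p) (coeff q) (coeff r) i ⟩
  (coeff p ⋆ coeff r) i ℚ.+ (coeff q ⋆ coeff r) i  ≡⟨ cong₂ ℚ._+_ (coeff-* p r i) (coeff-* q r i) ⟨
  coeff (p *ₚ r) i ℚ.+ coeff (q *ₚ r) i            ≡⟨ coeff-+ (p *ₚ r) (q *ₚ r) i ⟨
  coeff (p *ₚ r +ₚ q *ₚ r) i                       ∎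
  where open ≡-Reasoning

+ₚ-isCommutativeMonoid : IsCommutativeMonoid _≋_ _+ₚ_ []
+ₚ-isCommutativeMonoid = isCommutativeMonoidˡ record
  { isSemigroup = record
    { isMagma = record { isEquivalence = ≋-isEquivalence ; ∙-cong = +ₚ-cong }
    ; assoc   = +ₚ-assoc
    }
  ; identityˡ = λ p → ≈ₚ⇒≋ (λ _ → refl)
  ; comm      = +ₚ-comm
  }

*ₚ-isCommutativeMonoid : IsCommutativeMonoid _≋_ _*ₚ_ oneₚ
*ₚ-isCommutativeMonoid = isCommutativeMonoidˡ record
  { isSemigroup = record
    { isMagma = record { isEquivalence = ≋-isEquivalence ; ∙-cong = *ₚ-cong }
    ; assoc   = *ₚ-assoc
    }
  ; identityˡ = *ₚ-identityˡ
  ; comm      = *ₚ-comm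
  }

ℚ[X] : CommutativeSemiring 0ℓ 0ℓ
ℚ[X] = record
  { isCommutativeSemiring = isCommutativeSemiringˡ record
    { +-isCommutativeMonoid = +ₚ-isCommutativeMonoid
    ; *-isCommutativeMonoid = *ₚ-isCommutativeMonoid
    ; distribʳ              = *ₚ-distribʳ
    ; zeroˡ                 = λ p → ≈ₚ⇒≋ (λ _ → refl)
    }
  }

module ℚ[X] = CommutativeSemiring ℚ[X]
module ≋-Reasoning = SetoidReasoning ℚ[X].setoid

-- Cancelling monic linear factors

ℚ-*-cancelʳ : ∀ {c} x y → c ≢ 0ℚ → x ℚ.* c ≡ y ℚ.* c → x ≡ y
ℚ-*-cancelʳ {c} x y c≢0 xc≡yc = begin
  x                   ≡⟨ undo x ⟨
  x ℚ.* c ℚ.* ℚ.1/ c  ≡⟨ cong (ℚ._* ℚ.1/ c) xc≡yc ⟩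
  y ℚ.* c ℚ.* ℚ.1/ c  ≡⟨ undo y ⟩
  y                   ∎
  where
  open ≡-Reasoning
  instance _ = ℚ.≢-nonZero c≢0
  undo : ∀ z → z ℚ.* c ℚ.* ℚ.1/ c ≡ z
  undo z = trans (ℚP.*-assoc z c (ℚ.1/ c)) (trans (cong (z ℚ.*_) (ℚP.*-inverseʳ c)) (ℚP.*-identityʳ z))

coeff-*-X+c-suc : ∀ p c n → coeff (p *ₚ (c ∷ 1ℚ ∷ [])) (suc n) ≡ coeff p n ℚ.+ coeff p (suc n) ℚ.* c
coeff-*-X+c-suc p c n = begin
  coeff (p *ₚ (c ∷ 1ℚ ∷ [])) (suc n)                  ≡⟨ coeff-* p (c ∷ 1ℚ ∷ []) (suc n) ⟩
  (coeff p ⋆ coeff (c ∷ 1ℚ ∷ [])) (suc n)             ≡⟨ ⋆-sucʳ (coeff p) (coeff (c ∷ 1ℚ ∷ [])) n ⟩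
  (coeff p ⋆ coeff oneₚ) n ℚ.+ coeff p (suc n) ℚ.* c  ≡⟨ cong (ℚ._+ coeff p (suc n) ℚ.* c) p⋆1≡p ⟩
  coeff p n ℚ.+ coeff p (suc n) ℚ.* c                 ∎
  where
  open ≡-Reasoning
  p⋆1≡p : (coeff p ⋆ coeff oneₚ) n ≡ coeff p n
  p⋆1≡p = trans (⋆-comm (coeff p) (coeff oneₚ) n) (⋆-identityˡ (coeff p) n)

-- The coefficients of X^(n+1) give p n + p (n+1) c = q n + q (n+1) c: for c = 0 this already says
-- p n = q n, otherwise induct upwards from p 0 c = q 0 c.
*ₚ-cancelʳ-X+c : ∀ c {p q} → p *ₚ (c ∷ 1ℚ ∷ []) ≋ q *ₚ (c ∷ 1ℚ ∷ []) → p ≋ q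
*ₚ-cancelʳ-X+c c {p} {q} (≈ₚ⇒≋ pX≈qX) = ≈ₚ⇒≋ (cancel (c ℚ.≟ 0ℚ))
  where
  coeff-suc-eq : ∀ n → coeff p n ℚ.+ coeff p (suc n) ℚ.* c ≡ coeff q n ℚ.+ coeff q (suc n) ℚ.* c
  coeff-suc-eq n = trans (sym (coeff-*-X+c-suc p c n)) (trans (pX≈qX (suc n)) (coeff-*-X+c-suc q c n))
  cancel : Dec (c ≡ 0ℚ) → p ≈ₚ q
  cancel (yes refl) n = begin
    coeff p n                             ≡⟨ drop-0 (coeff p n) (coeff p (suc n)) ⟨
    coeff p n ℚ.+ coeff p (suc n) ℚ.* 0ℚ  ≡⟨ coeff-suc-eq n ⟩
    coeff q n ℚ.+ coeff q (suc n) ℚ.* 0ℚ  ≡⟨ drop-0 (coeff q n) (coeff q (suc n)) ⟩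
    coeff q n                             ∎
    where
    open ≡-Reasoning
    drop-0 : ∀ x y → x ℚ.+ y ℚ.* 0ℚ ≡ x
    drop-0 x y = trans (cong (x ℚ.+_) (ℚP.*-zeroʳ y)) (ℚP.+-identityʳ x)
  cancel (no c≢0) zero    = ℚ-*-cancelʳ (coeff p 0) (coeff q 0) c≢0
    (trans (sym (coeff-* p (c ∷ 1ℚ ∷ []) 0)) (trans (pX≈qX 0) (coeff-* q (c ∷ 1ℚ ∷ []) 0)))
  cancel (no c≢0) (suc n) = ℚ-*-cancelʳ (coeff p (suc n)) (coeff q (suc n)) c≢0
    (∙-cancelˡ (coeff p n) _ _
      (trans (coeff-suc-eq n) (cong (ℚ._+ coeff q (suc n) ℚ.* c) (sym (cancel (no c≢0) n)))))

*ₚ-cancelʳ-denAux : ∀ acc h {p q} → p *ₚ denAux acc h ≋ q *ₚ denAux acc h → p ≋ q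
*ₚ-cancelʳ-denAux acc []          {p} {q} p1≈q1 = begin
  p          ≈⟨ ℚ[X].*-identityʳ p ⟨
  p *ₚ oneₚ  ≈⟨ p1≈q1 ⟩
  q *ₚ oneₚ  ≈⟨ ℚ[X].*-identityʳ q ⟩
  q          ∎
  where open ≋-Reasoning
*ₚ-cancelʳ-denAux acc (x ∷ [])    p1≈q1 = *ₚ-cancelʳ-denAux acc [] p1≈q1
*ₚ-cancelʳ-denAux acc (x ∷ y ∷ h) {p} {q} pD≈qD =
  *ₚ-cancelʳ-X+c _ (*ₚ-cancelʳ-denAux (acc ℕ.+ x) (y ∷ h) (begin
    p *ₚ lin (acc ℕ.+ x) *ₚ D    ≈⟨ ℚ[X].*-assoc p (lin (acc ℕ.+ x)) D ⟩
    p *ₚ denAux acc (x ∷ y ∷ h)  ≈⟨ pD≈qD ⟩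
    q *ₚ denAux acc (x ∷ y ∷ h)  ≈⟨ ℚ[X].*-assoc q (lin (acc ℕ.+ x)) D ⟨
    q *ₚ lin (acc ℕ.+ x) *ₚ D    ∎))
  where
  open ≋-Reasoning
  D = denAux (acc ℕ.+ x) (y ∷ h)

module ListSum {c ℓ} (M : CommutativeMonoid c ℓ) where
  open CommutativeMonoid M renaming (refl to ≈-refl; sym to ≈-sym)
  open CommutativeSemigroupProperties commutativeSemigroup using (interchange)
  open SetoidReasoning setoid

  ∑ : (A → Carrier) → List A → Carrier
  ∑ f xs = foldr _∙_ ε (map f xs)

  ∑-map : ∀ (f : B → Carrier) (g : A → B) xs → ∑ f (map g xs) ≡ ∑ (f ∘ g) xs
  ∑-map f g xs = cong (foldr _∙_ ε) (sym (map-∘ xs))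

  ∑-cong-∈ : ∀ {f g : A → Carrier} xs → (∀ {x} → x ∈ xs → f x ≈ g x) → ∑ f xs ≈ ∑ g xs
  ∑-cong-∈ []       _   = ≈-refl
  ∑-cong-∈ (x ∷ xs) f≈g = ∙-cong (f≈g (here refl)) (∑-cong-∈ xs (f≈g ∘ there))

  ∑-++ : ∀ (f : A → Carrier) xs ys → ∑ f (xs ++ ys) ≈ ∑ f xs ∙ ∑ f ys
  ∑-++ f []       ys = ≈-sym (identityˡ (∑ f ys))
  ∑-++ f (x ∷ xs) ys = begin
    f x ∙ ∑ f (xs ++ ys)     ≈⟨ ∙-congˡ (∑-++ f xs ys) ⟩
    f x ∙ (∑ f xs ∙ ∑ f ys)  ≈⟨ assoc (f x) (∑ f xs) (∑ f ys) ⟨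
    f x ∙ ∑ f xs ∙ ∑ f ys    ∎

  ∑-concatMap : ∀ (f : B → Carrier) (g : A → List B) xs → ∑ f (concatMap g xs) ≈ ∑ (∑ f ∘ g) xs
  ∑-concatMap f g []       = ≈-refl
  ∑-concatMap f g (x ∷ xs) = begin
    ∑ f (g x ++ concatMap g xs)       ≈⟨ ∑-++ f (g x) (concatMap g xs) ⟩
    ∑ f (g x) ∙ ∑ f (concatMap g xs)  ≈⟨ ∙-congˡ (∑-concatMap f g xs) ⟩
    ∑ f (g x) ∙ ∑ (∑ f ∘ g) xs        ∎

  ∑-distrib : ∀ (f g : A → Carrier) xs → ∑ (λ x → f x ∙ g x) xs ≈ ∑ f xs ∙ ∑ g xs
  ∑-distrib f g []       = ≈-sym (identityˡ ε)
  ∑-distrib f g (x ∷ xs) = begin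
    (f x ∙ g x) ∙ ∑ (λ x → f x ∙ g x) xs  ≈⟨ ∙-congˡ (∑-distrib f g xs) ⟩
    (f x ∙ g x) ∙ (∑ f xs ∙ ∑ g xs)       ≈⟨ interchange (f x) (g x) (∑ f xs) (∑ g xs) ⟩
    (f x ∙ ∑ f xs) ∙ (g x ∙ ∑ g xs)       ∎

module _ {c ℓ} (R : CommutativeSemiring c ℓ) where
  open CommutativeSemiring R
    using (Carrier; _≈_; _+_; _*_; setoid; +-commutativeMonoid; +-congˡ; distribˡ; zeroʳ)
  open ListSum +-commutativeMonoid
  open SetoidReasoning setoid

  *-distribˡ-∑ : ∀ p (f : A → Carrier) xs → p * ∑ f xs ≈ ∑ (λ x → p * f x) xs
  *-distribˡ-∑ p f []       = zeroʳ p
  *-distribˡ-∑ p f (x ∷ xs) = begin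
    p * (f x + ∑ f xs)              ≈⟨ distribˡ p (f x) (∑ f xs) ⟩
    p * f x + p * ∑ f xs            ≈⟨ +-congˡ (*-distribˡ-∑ p f xs) ⟩
    p * f x + ∑ (λ x → p * f x) xs  ∎

-- Compositions

filter-concatMap : ∀ {P : Pred B p} (P? : Decidable P) (g : A → List B) xs →
                   filter P? (concatMap g xs) ≡ concatMap (filter P? ∘ g) xs
filter-concatMap P? g []       = refl
filter-concatMap P? g (x ∷ xs) = begin
  filter P? (g x ++ concatMap g xs)                ≡⟨ filter-++ P? (g x) (concatMap g xs) ⟩
  filter P? (g x) ++ filter P? (concatMap g xs)    ≡⟨ cong (filter P? (g x) ++_) (filter-concatMap P? g xs) ⟩
  filter P? (g x) ++ concatMap (filter P? ∘ g) xs  ∎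
  where open ≡-Reasoning

filter-map : ∀ {P : Pred B p} (P? : Decidable P) (f : A → B) xs →
             filter P? (map f xs) ≡ map f (filter (P? ∘ f) xs)
filter-map P? f []       = refl
filter-map P? f (x ∷ xs) with does (P? (f x))
... | true  = cong (f x ∷_) (filter-map P? f xs)
... | false = filter-map P? f xs

concatMap-upTo-suc : ∀ (g : ℕ → List A) n → concatMap g (upTo (suc n)) ≡ concatMap g (upTo n) ++ g n
concatMap-upTo-suc g n = begin
  concatMap g (upTo (suc n))           ≡⟨ cong (concatMap g) (upTo-∷ʳ n) ⟨
  concatMap g (upTo n ∷ʳ n)            ≡⟨ concatMap-++ g (upTo n) [ n ] ⟩
  concatMap g (upTo n) ++ (g n ++ [])  ≡⟨ cong (concatMap g (upTo n) ++_) (++-identityʳ (g n)) ⟩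
  concatMap g (upTo n) ++ g n          ∎
  where open ≡-Reasoning

concatMap-upTo-≤′ : ∀ (g : ℕ → List A) {s n} → (∀ {a} → s ≤ a → a < n → g a ≡ []) → s ≤′ n →
                    concatMap g (upTo n) ≡ concatMap g (upTo s)
concatMap-upTo-≤′ g     g≡[] ℕ.≤′-refl             = refl
concatMap-upTo-≤′ g {s} g≡[] (ℕ.≤′-step {n} s≤′n) = begin
  concatMap g (upTo (suc n))   ≡⟨ concatMap-upTo-suc g n ⟩
  concatMap g (upTo n) ++ g n  ≡⟨ cong (concatMap g (upTo n) ++_) (g≡[] (ℕP.≤′⇒≤ s≤′n) ℕP.≤-refl) ⟩
  concatMap g (upTo n) ++ []   ≡⟨ ++-identityʳ _ ⟩
  concatMap g (upTo n)         ≡⟨ concatMap-upTo-≤′ g (λ s≤a a<n → g≡[] s≤a (ℕP.m<n⇒m<1+n a<n)) s≤′n ⟩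
  concatMap g (upTo s)         ∎
  where open ≡-Reasoning

compositions : ℕ → ℕ → List (List ℕ)
compositions zero    zero    = [ [] ]
compositions zero    (suc s) = []
compositions (suc m) s       = concatMap (λ a → map (suc a ∷_) (compositions m (s ∸ suc a))) (upTo s)

record IsComposition (m s : ℕ) (h : List ℕ) : Set where
  constructor isComposition
  field
    length≡  : length h ≡ m
    positive : All (0 <_) h
    sum≡     : sum h ≡ s

∈-compositions⁻ : ∀ m s {h} → h ∈ compositions m s → IsComposition m s h
∈-compositions⁻ zero    zero (here refl) = isComposition refl [] refl
∈-compositions⁻ (suc m) s    h∈
  with a , a∈ , h∈′ ← find (∈-concatMap⁻ (λ a → map (suc a ∷_) (compositions m (s ∸ suc a))) {upTo s} h∈)
  with t , t∈ , refl ← ∈-map⁻ (suc a ∷_) h∈′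
  with isComposition length≡ positive sum≡ ← ∈-compositions⁻ m (s ∸ suc a) t∈ =
  isComposition (cong suc length≡) (z<s ∷ positive)
                (trans (cong (suc a ℕ.+_) sum≡) (ℕP.m+[n∸m]≡n (∈-upTo⁻ a∈)))

∈-compositions⁺ : ∀ m s {h} → IsComposition m s h → h ∈ compositions m s
∈-compositions⁺ zero    zero {[]}        _ = here refl
∈-compositions⁺ (suc m) s    {suc a ∷ t} (isComposition length≡ (_ ∷ positive) sum≡) =
  ∈-concatMap⁺ _ (lose (∈-upTo⁺ a<s) (∈-map⁺ (suc a ∷_)
    (∈-compositions⁺ m (s ∸ suc a) (isComposition (ℕP.suc-injective length≡) positive
      (trans (sym (ℕP.m+n∸m≡n (suc a) (sum t))) (cong (_∸ suc a) sum≡))))))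
  where
  a<s : a < s
  a<s = ℕP.≤-trans (ℕP.m≤m+n (suc a) (sum t)) (ℕP.≤-reflexive sum≡)

incLast : List ℕ → List ℕ
incLast []          = []
incLast (x ∷ [])    = suc x ∷ []
incLast (x ∷ y ∷ h) = x ∷ incLast (y ∷ h)

length-incLast : ∀ h → length (incLast h) ≡ length h
length-incLast []          = refl
length-incLast (x ∷ [])    = refl
length-incLast (x ∷ y ∷ h) = cong suc (length-incLast (y ∷ h))

sum-incLast : ∀ x h → sum (incLast (x ∷ h)) ≡ suc (sum (x ∷ h))
sum-incLast x []      = refl
sum-incLast x (y ∷ h) = trans (cong (x ℕ.+_) (sum-incLast y h)) (ℕP.+-suc x (sum (y ∷ h)))

positive-incLast : ∀ {h} → All (0 <_) h → All (0 <_) (incLast h)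
positive-incLast []                  = []
positive-incLast (_ ∷ [])            = z<s ∷ []
positive-incLast (x>0 ∷ pos@(_ ∷ _)) = x>0 ∷ positive-incLast pos

incLast-∈-compositions : ∀ m s {h} → h ∈ compositions (suc m) s → incLast h ∈ compositions (suc m) (suc s)
incLast-∈-compositions m s {[]}    h∈ with () ← IsComposition.length≡ (∈-compositions⁻ (suc m) s h∈)
incLast-∈-compositions m s {x ∷ h} h∈
  with isComposition length≡ positive sum≡ ← ∈-compositions⁻ (suc m) s h∈ =
  ∈-compositions⁺ (suc m) (suc s)
    (isComposition (trans (length-incLast (x ∷ h)) length≡) (positive-incLast positive)
                   (trans (sum-incLast x h) (cong suc sum≡)))

∷ʳ1-∈-compositions : ∀ m s {h} → h ∈ compositions m s → h ∷ʳ 1 ∈ compositions (suc m) (suc s)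
∷ʳ1-∈-compositions m s {h} h∈
  with isComposition length≡ positive sum≡ ← ∈-compositions⁻ m s h∈ =
  ∈-compositions⁺ (suc m) (suc s)
    (isComposition (trans (length-++ h) (trans (ℕP.+-comm (length h) 1) (cong suc length≡)))
                   (∷ʳ⁺ positive z<s)
                   (trans (sum-++ h [ 1 ]) (trans (ℕP.+-comm (sum h) 1) (cong suc sum≡))))

incLast-∷-compositions : ∀ m s x {t} → t ∈ compositions (suc m) s → incLast (x ∷ t) ≡ x ∷ incLast t
incLast-∷-compositions m s x {[]}    t∈ with () ← IsComposition.length≡ (∈-compositions⁻ (suc m) s t∈)
incLast-∷-compositions m s x {_ ∷ _} _  = refl

filter-tuples : ∀ m {n s} → s ≤ n → filter (λ h → sum h ≟ s) (tuples n m) ≡ compositions m s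
filter-tuples zero    {s = zero}  _   = refl
filter-tuples zero    {s = suc s} _   = refl
filter-tuples (suc m) {n} {s}     s≤n = begin
  filter P? (concatMap (λ a → map (a ∷_) T) (map suc (upTo n)))
    ≡⟨ filter-concatMap P? (λ a → map (a ∷_) T) (map suc (upTo n)) ⟩
  concatMap (λ a → filter P? (map (a ∷_) T)) (map suc (upTo n))
    ≡⟨ concatMap-map (λ a → filter P? (map (a ∷_) T)) suc (upTo n) ⟩
  concatMap G (upTo n)
    ≡⟨ concatMap-upTo-≤′ G (λ s≤a _ → G-≥ s≤a) (ℕP.≤⇒≤′ s≤n) ⟩
  concatMap G (upTo s)
    ≡⟨ cong concat (map-cong-local (All.map G-< (all-upTo s))) ⟩
  compositions (suc m) s
    ∎
  where
  open ≡-Reasoning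
  T = tuples n m
  P? = λ (h : List ℕ) → sum h ≟ s
  G : ℕ → List (List ℕ)
  G a = filter P? (map (suc a ∷_) T)
  G-≥ : ∀ {a} → s ≤ a → G a ≡ []
  G-≥ {a} s≤a = trans (filter-map P? (suc a ∷_) T) (cong (map (suc a ∷_))
    (filter-none (P? ∘ (suc a ∷_)) (All.universal (λ t eq →
      ℕP.<-irrefl (sym eq) (ℕP.≤-trans (ℕ.s≤s s≤a) (ℕP.m≤m+n (suc a) (sum t)))) T)))
  G-< : ∀ {a} → a < s → G a ≡ map (suc a ∷_) (compositions m (s ∸ suc a))
  G-< {a} a<s = trans (filter-map P? (suc a ∷_) T) (cong (map (suc a ∷_)) (trans
    (filter-≐ _ (λ t → sum t ≟ s ∸ suc a)
      ( (λ eq → trans (sym (ℕP.m+n∸m≡n (suc a) _)) (cong (_∸ suc a) eq))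
      , (λ eq → trans (cong (suc a ℕ.+_) eq) (ℕP.m+[n∸m]≡n a<s)) ) T)
    (filter-tuples m (ℕP.≤-trans (ℕP.m∸n≤m s (suc a)) s≤n))))

H≡compositions : ∀ l k → H (+ l) k ≡ compositions (suc l) k
H≡compositions l k = filter-tuples (suc l) (ℕP.≤-refl {k})

compositions-one : ∀ s → compositions 1 (suc s) ≡ [ [ suc s ] ]
compositions-one s = begin
  concatMap g (upTo (suc s))   ≡⟨ concatMap-upTo-suc g s ⟩
  concatMap g (upTo s) ++ g s  ≡⟨ cong₂ _++_ (concatMap-upTo-≤′ g g-< (ℕP.≤⇒≤′ z≤n))
                                             (cong (map (suc s ∷_) ∘ compositions 0) (ℕP.n∸n≡0 s)) ⟩
  [ [ suc s ] ]                ∎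
  where
  open ≡-Reasoning
  g : ℕ → List (List ℕ)
  g a = map (suc a ∷_) (compositions 0 (suc s ∸ suc a))
  g-< : ∀ {a} → 0 ≤ a → a < s → g a ≡ []
  g-< {a} _ a<s = cong (map (suc a ∷_) ∘ compositions 0) (ℕP.+-∸-assoc 1 a<s)

module _ {c ℓ} (M : CommutativeMonoid c ℓ) where
  open CommutativeMonoid M renaming (sym to ≈-sym; trans to ≈-trans; reflexive to ≈-reflexive)
  open ListSum M
  open SetoidReasoning setoid

  ∑-compositions-byFirst : ∀ m s (f : List ℕ → Carrier) →
    ∑ f (compositions (suc m) s) ≈ ∑ (λ a → ∑ (f ∘ (suc a ∷_)) (compositions m (s ∸ suc a))) (upTo s)
  ∑-compositions-byFirst m s f = ≈-trans (∑-concatMap f _ (upTo s))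
    (∑-cong-∈ (upTo s) (λ {a} _ → ≈-reflexive (∑-map f (suc a ∷_) (compositions m (s ∸ suc a)))))

  ∑-compositions-byLast : ∀ m s (f : List ℕ → Carrier) →
    ∑ f (compositions (suc m) (suc s))
      ≈ ∑ (f ∘ incLast) (compositions (suc m) s) ∙ ∑ (f ∘ (_∷ʳ 1)) (compositions m s)
  ∑-compositions-byLast zero    zero    f = ≈-sym (identityˡ _)
  ∑-compositions-byLast zero    (suc s) f
    rewrite compositions-one (suc s) | compositions-one s = ≈-sym (identityʳ _)
  ∑-compositions-byLast (suc m) s       f = begin
    ∑ f (compositions (suc (suc m)) (suc s))  ≈⟨ ∑-compositions-byFirst (suc m) (suc s) f ⟩
    ∑ F (upTo (suc s))                        ≡⟨ cong (∑ F) (upTo-∷ʳ s) ⟨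
    ∑ F (upTo s ∷ʳ s)                         ≈⟨ ∑-++ F (upTo s) [ s ] ⟩
    ∑ F (upTo s) ∙ (F s ∙ ε)                  ≈⟨ ∙-congˡ (≈-trans (identityʳ (F s)) F-last) ⟩
    ∑ F (upTo s) ∙ ε                          ≈⟨ identityʳ _ ⟩
    ∑ F (upTo s)                              ≈⟨ ∑-cong-∈ (upTo s) (F-< ∘ ∈-upTo⁻) ⟩
    ∑ (λ a → F⁺ a ∙ F¹ a) (upTo s)            ≈⟨ ∑-distrib F⁺ F¹ (upTo s) ⟩
    ∑ F⁺ (upTo s) ∙ ∑ F¹ (upTo s)             ≈⟨ ∙-cong (∑-compositions-byFirst (suc m) s (f ∘ incLast))
                                                        (∑-compositions-byFirst m s (f ∘ (_∷ʳ 1))) ⟨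
    ∑ (f ∘ incLast) (compositions (suc (suc m)) s) ∙ ∑ (f ∘ (_∷ʳ 1)) (compositions (suc m) s) ∎
    where
    F F⁺ F¹ : ℕ → Carrier
    F  a = ∑ (f ∘ (suc a ∷_)) (compositions (suc m) (suc s ∸ suc a))
    F⁺ a = ∑ (f ∘ incLast ∘ (suc a ∷_)) (compositions (suc m) (s ∸ suc a))
    F¹ a = ∑ (f ∘ (_∷ʳ 1) ∘ (suc a ∷_)) (compositions m (s ∸ suc a))
    F-last : F s ≈ ε
    F-last = ≈-reflexive (cong (∑ (f ∘ (suc s ∷_)) ∘ compositions (suc m)) (ℕP.n∸n≡0 s))
    F-< : ∀ {a} → a < s → F a ≈ F⁺ a ∙ F¹ a
    F-< {a} a<s = begin
      F a
        ≡⟨ cong (∑ (f ∘ (suc a ∷_)) ∘ compositions (suc m)) (ℕP.+-∸-assoc 1 a<s) ⟩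
      ∑ (f ∘ (suc a ∷_)) (compositions (suc m) (suc (s ∸ suc a)))
        ≈⟨ ∑-compositions-byLast m (s ∸ suc a) (f ∘ (suc a ∷_)) ⟩
      ∑ (f ∘ (suc a ∷_) ∘ incLast) (compositions (suc m) (s ∸ suc a)) ∙ F¹ a
        ≈⟨ ∙-congʳ (∑-cong-∈ (compositions (suc m) (s ∸ suc a)) λ t∈ →
             ≈-reflexive (cong f (sym (incLast-∷-compositions m (s ∸ suc a) (suc a) t∈)))) ⟩
      F⁺ a ∙ F¹ a
        ∎

-- The quotients φ(h)

open ListSum ℚ[X].+-commutativeMonoid
open ListSum ℚ[X].*-commutativeMonoid using () renaming (∑ to ∏; ∑-++ to ∏-++)

num-suc : ∀ n → num (suc (suc n)) ≋ num (suc n) *ₚ lin (suc n)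
num-suc n = begin
  ∏ L (upTo (suc n))             ≡⟨ cong (∏ L) (upTo-∷ʳ n) ⟨
  ∏ L (upTo n ∷ʳ n)              ≈⟨ ∏-++ L (upTo n) [ n ] ⟩
  ∏ L (upTo n) *ₚ (L n *ₚ oneₚ)  ≈⟨ ℚ[X].*-congˡ {∏ L (upTo n)} (ℚ[X].*-identityʳ (L n)) ⟩
  ∏ L (upTo n) *ₚ L n            ∎
  where
  open ≋-Reasoning
  L : ℕ → Poly
  L m = lin (suc m)

denAux-incLast : ∀ acc h → denAux acc (incLast h) ≡ denAux acc h
denAux-incLast acc []              = refl
denAux-incLast acc (x ∷ [])        = refl
denAux-incLast acc (x ∷ y ∷ [])    = refl
denAux-incLast acc (x ∷ y ∷ z ∷ h) = cong (lin (acc ℕ.+ x) *ₚ_) (denAux-incLast (acc ℕ.+ x) (y ∷ z ∷ h))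

denAux-∷ʳ : ∀ acc y t x → denAux acc ((y ∷ t) ∷ʳ x) ≋ denAux acc (y ∷ t) *ₚ lin (acc ℕ.+ sum (y ∷ t))
denAux-∷ʳ acc y []      x = begin
  lin (acc ℕ.+ y) *ₚ oneₚ          ≈⟨ ℚ[X].*-comm (lin (acc ℕ.+ y)) oneₚ ⟩
  oneₚ *ₚ lin (acc ℕ.+ y)          ≡⟨ cong (λ z → oneₚ *ₚ lin (acc ℕ.+ z)) (ℕP.+-identityʳ y) ⟨
  oneₚ *ₚ lin (acc ℕ.+ (y ℕ.+ 0))  ∎
  where open ≋-Reasoning
denAux-∷ʳ acc y (z ∷ t) x = begin
  L *ₚ denAux (acc ℕ.+ y) ((z ∷ t) ∷ʳ x)       ≈⟨ ℚ[X].*-congˡ {L} (denAux-∷ʳ (acc ℕ.+ y) z t x) ⟩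
  L *ₚ (D *ₚ lin (acc ℕ.+ y ℕ.+ sum (z ∷ t)))  ≈⟨ ℚ[X].*-assoc L D _ ⟨
  L *ₚ D *ₚ lin (acc ℕ.+ y ℕ.+ sum (z ∷ t))    ≡⟨ cong (λ w → L *ₚ D *ₚ lin w) (ℕP.+-assoc acc y (sum (z ∷ t))) ⟩
  L *ₚ D *ₚ lin (acc ℕ.+ (y ℕ.+ sum (z ∷ t)))  ∎
  where
  open ≋-Reasoning
  L = lin (acc ℕ.+ y)
  D = denAux (acc ℕ.+ y) (z ∷ t)

quotient-incLast : ∀ n h {p q} → p *ₚ den h ≋ num (suc n) → q *ₚ den (incLast h) ≋ num (suc (suc n)) →
                   q ≋ lin (suc n) *ₚ p
quotient-incLast n h {p} {q} pD≈N qD≈N′ = *ₚ-cancelʳ-denAux 0 h (begin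
  q *ₚ den h                   ≡⟨ cong (q *ₚ_) (denAux-incLast 0 h) ⟨
  q *ₚ den (incLast h)         ≈⟨ qD≈N′ ⟩
  num (suc (suc n))            ≈⟨ num-suc n ⟩
  num (suc n) *ₚ lin (suc n)   ≈⟨ ℚ[X].*-congʳ {lin (suc n)} (ℚ[X].sym pD≈N) ⟩
  p *ₚ den h *ₚ lin (suc n)    ≈⟨ ℚ[X].*-comm (p *ₚ den h) (lin (suc n)) ⟩
  lin (suc n) *ₚ (p *ₚ den h)  ≈⟨ ℚ[X].*-assoc (lin (suc n)) p (den h) ⟨
  lin (suc n) *ₚ p *ₚ den h    ∎)
  where open ≋-Reasoning

quotient-∷ʳ1 : ∀ n h {p q} → sum h ≡ suc n → p *ₚ den h ≋ num (suc n) →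
               q *ₚ den (h ∷ʳ 1) ≋ num (suc (suc n)) → q ≋ p
quotient-∷ʳ1 n (y ∷ t) {p} {q} Σh≡1+n pD≈N qD≈N′ = *ₚ-cancelʳ-denAux 0 (y ∷ t) (*ₚ-cancelʳ-X+c _ (begin
  q *ₚ D *ₚ lin (suc n)          ≈⟨ ℚ[X].*-assoc q D (lin (suc n)) ⟩
  q *ₚ (D *ₚ lin (suc n))        ≡⟨ cong (λ s → q *ₚ (D *ₚ lin s)) Σh≡1+n ⟨
  q *ₚ (D *ₚ lin (sum (y ∷ t)))  ≈⟨ ℚ[X].*-congˡ {q} (denAux-∷ʳ 0 y t 1) ⟨
  q *ₚ den ((y ∷ t) ∷ʳ 1)        ≈⟨ qD≈N′ ⟩
  num (suc (suc n))              ≈⟨ num-suc n ⟩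
  num (suc n) *ₚ lin (suc n)     ≈⟨ ℚ[X].*-congʳ {lin (suc n)} (ℚ[X].sym pD≈N) ⟩
  p *ₚ D *ₚ lin (suc n)          ∎))
  where
  open ≋-Reasoning
  D = den (y ∷ t)

mainTheorem3 : (φ : List ℕ → Poly)
    → (∀ (j : ℤ) (n : ℕ) (h : List ℕ) → h ∈ H j n → φ h *ₚ den h ≈ₚ num n)
    → (k : ℕ) → 1 ≤ k → (ℓ : ℤ)
    → sumₚ (map φ (H ℓ (suc k)))
      ≈ₚ lin k *ₚ sumₚ (map φ (H ℓ k)) +ₚ sumₚ (map φ (H (ℓ - + 1) k))
mainTheorem3 φ φ-quotient zero    ()
mainTheorem3 φ φ-quotient (suc k) _  -[1+ _ ] =
  ≋⇒≈ₚ (ℚ[X].sym (ℚ[X].trans (ℚ[X].+-identityʳ _) (ℚ[X].zeroʳ (lin (suc k)))))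
mainTheorem3 φ φ-quotient (suc k) _  (+ l)    = ≋⇒≈ₚ (begin
  ∑ φ (H (+ l) (suc K))
    ≡⟨ cong (∑ φ) (H≡compositions l (suc K)) ⟩
  ∑ φ (compositions (suc l) (suc K))
    ≈⟨ ∑-compositions-byLast ℚ[X].+-commutativeMonoid l K φ ⟩
  ∑ (φ ∘ incLast) (compositions (suc l) K) +ₚ ∑ (φ ∘ (_∷ʳ 1)) (compositions l K)
    ≈⟨ ℚ[X].+-cong incLast-part (∷ʳ1-part l) ⟩
  ∑ (λ h → lin K *ₚ φ h) (compositions (suc l) K) +ₚ ∑ φ (H (+ l - + 1) K)
    ≈⟨ ℚ[X].+-congʳ {∑ φ (H (+ l - + 1) K)} (*-distribˡ-∑ ℚ[X] (lin K) φ (compositions (suc l) K)) ⟨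
  lin K *ₚ ∑ φ (compositions (suc l) K) +ₚ ∑ φ (H (+ l - + 1) K)
    ≡⟨ cong (λ hs → lin K *ₚ ∑ φ hs +ₚ ∑ φ (H (+ l - + 1) K)) (H≡compositions l K) ⟨
  lin K *ₚ ∑ φ (H (+ l) K) +ₚ ∑ φ (H (+ l - + 1) K)
    ∎)
  where
  open ≋-Reasoning
  K = suc k
  quotient : ∀ m n {h} → h ∈ compositions (suc m) n → φ h *ₚ den h ≋ num n
  quotient m n {h} h∈ = ≈ₚ⇒≋ (φ-quotient (+ m) n h (subst (h ∈_) (sym (H≡compositions m n)) h∈))
  incLast-part : ∑ (φ ∘ incLast) (compositions (suc l) K) ≋ ∑ (λ h → lin K *ₚ φ h) (compositions (suc l) K)
  incLast-part = ∑-cong-∈ (compositions (suc l) K) λ {h} h∈ →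
    quotient-incLast k h (quotient l K h∈) (quotient l (suc K) (incLast-∈-compositions l K h∈))
  ∷ʳ1-part : ∀ l → ∑ (φ ∘ (_∷ʳ 1)) (compositions l K) ≋ ∑ φ (H (+ l - + 1) K)
  ∷ʳ1-part zero    = ℚ[X].refl
  ∷ʳ1-part (suc l) = ℚ[X].trans
    (∑-cong-∈ (compositions (suc l) K) λ {h} h∈ →
      quotient-∷ʳ1 k h (IsComposition.sum≡ (∈-compositions⁻ (suc l) K h∈))
        (quotient l K h∈) (quotient (suc l) (suc K) (∷ʳ1-∈-compositions (suc l) K h∈)))
    (ℚ[X].reflexive (cong (∑ φ) (sym (H≡compositions l K))))
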